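{- A graph $G$ belongs to $\Gamma_2$ if and only if every vertex of $G$ belongs to at most $2$ mp-subgraphs of $G$.
   Context: All graphs are finite, simple and undirected. A connected graph is prime if it has no clique separator (a clique whose removal disconnects it); an mp-subgraph of $G$ is a maximal induced subgraph of $G$ that is prime; $\mathcal{M}(G)$ is the family of mp-subgraphs of $G$. $\Omega(\mathcal{M}(G))$ is the intersection graph of $\mathcal{M}(G)$: its vertices are the mp-subgraphs, two being adjacent when they share a vertex. $\Gamma_2$ is the class of graphs $G$ for which $\Omega(\mathcal{M}(G))$ is a tree. -}

module Defs where

open import Data.Nat using (ℕ; _≤_)
open import Data.Bool using (Bool; true; false; T)
open import Data.Fin using (Fin)
open import Data.Fin.Subset using (Subset; _∈_; _∉_; _⊆_; _─_)
open import Data.List using (List; []; _∷_; length; _∷ʳ_)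
open import Data.List.Relation.Unary.All using (All)
open import Data.List.Relation.Unary.Unique.Propositional using (Unique)
open import Data.Product using (Σ; ∃; ∃-syntax; _×_)
open import Data.Sum using (_⊎_)
open import Data.Unit using (⊤)
open import Relation.Nullary using (¬_)
open import Relation.Binary.PropositionalEquality using (_≡_; _≢_)

record Graph (n : ℕ) : Set where
  field
    adj   : Fin n → Fin n → Bool
    sym   : ∀ u v → adj u v ≡ adj v u
    irrefl : ∀ u → adj u u ≡ false

open Graph public

module _ {n : ℕ} (G : Graph n) where

  Adj : Fin n → Fin n → Set
  Adj u v = T (adj G u v)

  data PathIn (S : Subset n) : Fin n → Fin n → Set where
    here : ∀ {u} → u ∈ S → PathIn S u u
    step : ∀ {u w v} → u ∈ S → Adj u w → PathIn S w v → PathIn S u v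

  Connected : Subset n → Set
  Connected S = (∃[ u ] u ∈ S) × (∀ u v → u ∈ S → v ∈ S → PathIn S u v)

  IsClique : Subset n → Set
  IsClique C = ∀ u v → u ∈ C → v ∈ C → u ≢ v → Adj u v

  IsCliqueSeparator : Subset n → Subset n → Set
  IsCliqueSeparator S C =
    C ⊆ S × IsClique C ×
    (∃[ u ] ∃[ v ] (u ∈ (S ─ C) × v ∈ (S ─ C) × ¬ PathIn (S ─ C) u v))

  IsPrime : Subset n → Set
  IsPrime S = Connected S × (∀ C → ¬ IsCliqueSeparator S C)

  IsMP : Subset n → Set
  IsMP S = IsPrime S × (∀ T → S ⊆ T → IsPrime T → T ⊆ S)

  ΩAdj : Subset n → Subset n → Set
  ΩAdj A B = IsMP A × IsMP B × A ≢ B × (∃[ v ] (v ∈ A × v ∈ B))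

  data ΩPath : Subset n → Subset n → Set where
    here : ∀ {A} → IsMP A → ΩPath A A
    step : ∀ {A B C} → ΩAdj A B → ΩPath B C → ΩPath A C

  ΩConnected : Set
  ΩConnected = (∃[ A ] IsMP A) × (∀ A B → IsMP A → IsMP B → ΩPath A B)

  Linked : List (Subset n) → Set
  Linked [] = ⊤
  Linked (_ ∷ []) = ⊤
  Linked (A ∷ B ∷ rest) = ΩAdj A B × Linked (B ∷ rest)

  ΩHasCycle : Set
  ΩHasCycle = ∃[ A ] ∃[ rest ]
    (2 ≤ length rest × All IsMP (A ∷ rest) × Unique (A ∷ rest) × Linked ((A ∷ rest) ∷ʳ A))

  ΩIsTree : Set
  ΩIsTree = ΩConnected × ¬ ΩHasCycle

  InΓ₂ : Set
  InΓ₂ = ΩIsTree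

  InAtMostTwoMP : Fin n → Set
  InAtMostTwoMP v = ∀ A B C → IsMP A → IsMP B → IsMP C →
    v ∈ A → v ∈ B → v ∈ C → A ≡ B ⊎ A ≡ C ⊎ B ≡ C

module Submission where

-- Every edge of G lies in an mp-subgraph, so a path of G gives a walk in Ω(M(G)); and three
-- mp-subgraphs through one vertex form a triangle of Ω(M(G)).
--
-- Conversely, let every vertex lie in at most two mp-subgraphs and let A₀ … A_{L-1} be a cycle
-- of Ω(M(G)), with x_t ∈ A_t ∩ A_{t+1}.  Consider prime sets P_t containing x_{t-1} and x_t
-- (initially P_t = A_t) and their connected union X.  X is not prime, since an mp-subgraph
-- containing it would contain x₀, x₁, x₂.  So X has a clique separator S.  Walking round the
-- cycle, the sets P_t − S stay in one component of X − S except across links x_t ∈ S, so two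
-- such links are met; being adjacent they lie in a common mp-subgraph, which forces them to be
-- consecutive links x_{i-1}, x_i with P_i ⊄ S.  Replacing P_i by the edge x_{i-1}x_i lowers
-- Σ_t |P_t|, and this descent cannot go on forever.

open import Defs hiding (sym)
open import Data.Bool using (T)
import Data.Bool as Bool
open import Data.Bool.Properties using (T?)
open import Data.Empty using (⊥; ⊥-elim)
open import Data.Fin using (Fin; _≟_)
open import Data.Fin.Properties using (any?; all?)
open import Data.Fin.Subset
  using (Subset; ∣_∣; _∈_; _∉_; _⊆_; _⊂_; _⊃_; _─_; _-_; ⁅_⁆; _∪_; _∩_; ⊤; inside)
  renaming (⊥ to ∅)
open import Data.Fin.Subset.Properties
  using (_∈?_; _⊆?_; _⊂?_; anySubset?; ∈⊤; ∉⊥; x∈⁅x⁆; x∈⁅y⁆⇒x≡y; x∈p∪q⁺; x∈p∪q⁻; x∈p∩q⁺;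
         p∩q⊆p; p∩q⊆q; p─q⊆p; x∈p∧x∉q⇒x∈p─q; x∈p∧x≢y⇒x∈p-y; x∈p⇒p-x⊂p; p⊂q⇒∣p∣<∣q∣)
open import Data.Fin.Subset.Induction using (⊂-wellFounded; ⊃-wellFounded)
open import Data.List using (List; []; _∷_; length; _∷ʳ_)
open import Data.List.Relation.Unary.All using (All; []; _∷_)
open import Data.List.Relation.Unary.AllPairs using ([]; _∷_)
open import Data.List.Relation.Unary.Unique.Propositional using (Unique)
open import Data.Nat
  using (ℕ; zero; suc; pred; _+_; _%_; _≤_; _<_; _≤′_; _≤‴_; z≤n; s≤s; NonZero; >-nonZero⁻¹;
         ≤′-refl; ≤′-step; ≤‴-refl; ≤‴-step)
import Data.Nat as ℕ
open import Data.Nat.DivMod using (m%n%n≡m%n; [m+n]%n≡m%n; %-distribˡ-+; m<n⇒m%n≡m; m%n<n; n%n≡0)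
open import Data.Nat.Induction using (<-wellFounded)
open import Data.Nat.Properties
  using (≤-refl; ≤-trans; ≤-antisym; ≤-total; <⇒≤; <⇒≢; <-≤-trans; ≤-<-trans; n<1+n; m<n⇒m<1+n;
         m≤n⇒m<n∨m≡n; m≤n⇒∃[o]m+o≡n; ≤⇒≤′; ≤′⇒≤; ≤⇒≤‴; ≤‴⇒≤; m≤n+m; suc-pred;
         +-suc; +-comm; +-identityʳ; +-cancelˡ-<; +-mono-≤; +-mono-<-≤; +-mono-≤-<; +-monoʳ-<; +-monoˡ-≤)
open import Data.Product using (Σ; ∃-syntax; ∃₂; _×_; _,_; proj₁; proj₂)
open import Data.Sum using (_⊎_; inj₁; inj₂)
open import Data.Unit using (tt)
open import Data.Vec using (_∷_; here; there)
open import Data.Vec.Properties using (≡-dec)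
open import Function using (_∘_; id)
open import Induction.WellFounded using (Acc; acc)
open import Relation.Nullary using (¬_; Dec; yes; no)
open import Relation.Nullary.Decidable using (_×-dec_; _→-dec_; ¬?; map′)
open import Relation.Unary using (Decidable)
open import Relation.Binary.PropositionalEquality
  using (_≡_; _≢_; refl; sym; trans; cong; subst; ≢-sym; module ≡-Reasoning)

-- Residues modulo L

module Modulo (L : ℕ) .{{_ : NonZero L}} where

  infix 4 _≈_ _≈?_

  _≈_ : ℕ → ℕ → Set
  s ≈ t = s % L ≡ t % L

  _≈?_ : ∀ s t → Dec (s ≈ t)
  s ≈? t = s % L ℕ.≟ t % L

  Periodic : ∀ {a} {B : Set a} → (ℕ → B) → Set a
  Periodic f = ∀ s t → s ≈ t → f s ≡ f t

  %-≈ : ∀ t → t % L ≈ t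
  %-≈ t = m%n%n≡m%n t L

  +L-≈ : ∀ t → t + L ≈ t
  +L-≈ t = [m+n]%n≡m%n t L

  +-congˡ-≈ : ∀ k {s t} → s ≈ t → k + s ≈ k + t
  +-congˡ-≈ k {s} {t} s≈t = begin
    (k + s) % L             ≡⟨ %-distribˡ-+ k s L ⟩
    (k % L + s % L) % L     ≡⟨ cong (λ r → (k % L + r) % L) s≈t ⟩
    (k % L + t % L) % L     ≡⟨ %-distribˡ-+ k t L ⟨
    (k + t) % L             ∎
    where open ≡-Reasoning

  suc-cancel-≈ : ∀ {s t} → suc s ≈ suc t → s ≈ t
  suc-cancel-≈ {s} {t} e = begin
    s % L                   ≡⟨ +L-≈ s ⟨
    (s + L) % L             ≡⟨ cong (_% L) (shift s) ⟨
    (pred L + suc s) % L    ≡⟨ +-congˡ-≈ (pred L) e ⟩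
    (pred L + suc t) % L    ≡⟨ cong (_% L) (shift t) ⟩
    (t + L) % L             ≡⟨ +L-≈ t ⟩
    t % L                   ∎
    where
    open ≡-Reasoning
    shift : ∀ r → pred L + suc r ≡ r + L
    shift r = trans (+-suc (pred L) r) (trans (cong (_+ r) (suc-pred L)) (+-comm L r))

  +-cancelˡ-≈ : ∀ k {s t} → k + s ≈ k + t → s ≈ t
  +-cancelˡ-≈ zero    e = e
  +-cancelˡ-≈ (suc k) e = +-cancelˡ-≈ k (suc-cancel-≈ e)

  ≉-within-period : ∀ {s t} → s < t → t < s + L → ¬ s ≈ t
  ≉-within-period {s} s<t t<s+L s≈t with m≤n⇒∃[o]m+o≡n (<⇒≤ s<t)
  ... | d , refl = <⇒≢ 0<d (begin
    0           ≡⟨ m<n⇒m%n≡m (>-nonZero⁻¹ L) ⟨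
    0 % L       ≡⟨ +-cancelˡ-≈ s (trans (cong (_% L) (+-identityʳ s)) s≈t) ⟩
    d % L       ≡⟨ m<n⇒m%n≡m (+-cancelˡ-< s d L t<s+L) ⟩
    d           ∎)
    where
    open ≡-Reasoning
    0<d : 0 < d
    0<d = +-cancelˡ-< s 0 d (subst (_< s + d) (sym (+-identityʳ s)) s<t)

module Crossing (C C′ Z : ℕ → Set) (Z? : Decidable Z)
  (C-forward : ∀ {t} → C t → ¬ Z t → C (suc t))
  (C′-backward : ∀ {t} → C′ (suc t) → ¬ Z t → C′ t)
  (exclusive : ∀ {t} → C t → ¬ C′ t) where

  first-barrier : ∀ {p q} → p ≤‴ q → C p → C′ q → ∃[ j ] p ≤ j × j < q × Z j × C j
  first-barrier ≤‴-refl Cp C′p = ⊥-elim (exclusive Cp C′p)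
  first-barrier {p} (≤‴-step p<q) Cp C′q with Z? p
  ... | yes Zp  = p , ≤-refl , ≤‴⇒≤ p<q , Zp , Cp
  ... | no  ¬Zp with first-barrier p<q (C-forward Cp ¬Zp) C′q
  ...   | j , p<j , j<q , Zj , Cj = j , <⇒≤ p<j , j<q , Zj , Cj

  last-barrier : ∀ {p q} → p ≤′ q → ¬ C′ p → C′ q → ∃[ f ] p ≤ f × f < q × Z f × C′ (suc f)
  last-barrier ≤′-refl ¬C′p C′p = ⊥-elim (¬C′p C′p)
  last-barrier {q = suc q} (≤′-step p≤q) ¬C′p C′q+1 with Z? q
  ... | yes Zq  = q , ≤′⇒≤ p≤q , n<1+n q , Zq , C′q+1
  ... | no  ¬Zq with last-barrier p≤q ¬C′p (C′-backward C′q+1 ¬Zq)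
  ...   | f , p≤f , f<q , Zf , C′f+1 = f , p≤f , m<n⇒m<1+n f<q , Zf , C′f+1

  crossing : ∀ {p q} → p ≤ q → C p → C′ q →
    ∃₂ λ j f → p ≤ j × j ≤ f × f < q × Z j × Z f × C j × C′ (suc f)
  crossing p≤q Cp C′q with first-barrier (≤⇒≤‴ p≤q) Cp C′q
  ... | j , p≤j , j<q , Zj , Cj with last-barrier (≤⇒≤′ (<⇒≤ j<q)) (exclusive Cj) C′q
  ...   | f , j≤f , f<q , Zf , C′f+1 = j , f , p≤j , j≤f , f<q , Zj , Zf , Cj , C′f+1

sumBelow : (ℕ → ℕ) → ℕ → ℕ
sumBelow f zero    = 0
sumBelow f (suc k) = f k + sumBelow f k

sumBelow-mono-≤ : ∀ {f g} k → (∀ r → f r ≤ g r) → sumBelow f k ≤ sumBelow g k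
sumBelow-mono-≤ zero    f≤g = z≤n
sumBelow-mono-≤ (suc k) f≤g = +-mono-≤ (f≤g k) (sumBelow-mono-≤ k f≤g)

sumBelow-mono-< : ∀ {f g k r} → (∀ r → f r ≤ g r) → r < k → f r < g r → sumBelow f k < sumBelow g k
sumBelow-mono-< {k = suc k} {r} f≤g (s≤s r≤k) fr<gr with m≤n⇒m<n∨m≡n r≤k
... | inj₂ refl = +-mono-<-≤ fr<gr (sumBelow-mono-≤ r f≤g)
... | inj₁ r<k  = +-mono-≤-< (f≤g k) (sumBelow-mono-< f≤g r<k fr<gr)

x∈p─q⇒x∉q : ∀ {n} {x : Fin n} (p q : Subset n) → x ∈ p ─ q → x ∉ q
x∈p─q⇒x∉q (_ ∷ p) (inside ∷ q) () here
x∈p─q⇒x∉q (_ ∷ p) (_ ∷ q) (there x∈p─q) (there x∈q) = x∈p─q⇒x∉q p q x∈p─q x∈q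

_≟ₛ_ : ∀ {n} (A B : Subset n) → Dec (A ≡ B)
_≟ₛ_ = ≡-dec Bool._≟_

module _ {n : ℕ} where

  ⋃below : (ℕ → Subset n) → ℕ → Subset n
  ⋃below P zero    = ∅
  ⋃below P (suc k) = P k ∪ ⋃below P k

  ⊆-⋃below : ∀ P {r k} → r < k → P r ⊆ ⋃below P k
  ⊆-⋃below P {r} {suc k} (s≤s r≤k) y∈Pr with m≤n⇒m<n∨m≡n r≤k
  ... | inj₂ refl = x∈p∪q⁺ (inj₁ y∈Pr)
  ... | inj₁ r<k  = x∈p∪q⁺ (inj₂ (⊆-⋃below P r<k y∈Pr))

  ∈-⋃below⁻ : ∀ P k {y} → y ∈ ⋃below P k → ∃[ r ] r < k × y ∈ P r
  ∈-⋃below⁻ P zero    y∈ = ⊥-elim (∉⊥ y∈)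
  ∈-⋃below⁻ P (suc k) y∈ with x∈p∪q⁻ (P k) (⋃below P k) y∈
  ... | inj₁ y∈Pk = k , ≤-refl , y∈Pk
  ... | inj₂ y∈⋃  with ∈-⋃below⁻ P k y∈⋃
  ...   | r , r<k , y∈Pr = r , m<n⇒m<1+n r<k , y∈Pr

-- Paths, primality and mp-subgraphs

module GraphTheory {n : ℕ} (G : Graph n) where

  Adj-sym : ∀ {u v} → Adj G u v → Adj G v u
  Adj-sym {u} {v} = subst T (Graph.sym G u v)

  PathIn-head : ∀ {S u v} → PathIn G S u v → u ∈ S
  PathIn-head (here u∈S)     = u∈S
  PathIn-head (step u∈S _ _) = u∈S

  PathIn-mono : ∀ {S S′ u v} → S ⊆ S′ → PathIn G S u v → PathIn G S′ u v
  PathIn-mono S⊆S′ (here u∈S)       = here (S⊆S′ u∈S)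
  PathIn-mono S⊆S′ (step u∈S uw wv) = step (S⊆S′ u∈S) uw (PathIn-mono S⊆S′ wv)

  infixr 5 _++ₚ_
  _++ₚ_ : ∀ {S u w v} → PathIn G S u w → PathIn G S w v → PathIn G S u v
  here _          ++ₚ q = q
  step u∈S uw′ p  ++ₚ q = step u∈S uw′ (p ++ₚ q)

  PathIn-reverse : ∀ {S u v} → PathIn G S u v → PathIn G S v u
  PathIn-reverse (here u∈S)       = here u∈S
  PathIn-reverse (step u∈S uw wv) =
    PathIn-reverse wv ++ₚ step (PathIn-head wv) (Adj-sym uw) (here u∈S)

  -- Cut a path just after its last visit to x.
  PathIn-avoid : ∀ {S u v} x → PathIn G S u v →
    PathIn G (S - x) u v ⊎ (x ≡ v ⊎ ∃[ w ] Adj G x w × PathIn G (S - x) w v)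
  PathIn-avoid {u = u} x (here u∈S) with u ≟ x
  ... | yes refl = inj₂ (inj₁ refl)
  ... | no u≢x   = inj₁ (here (x∈p∧x≢y⇒x∈p-y u∈S u≢x))
  PathIn-avoid {u = u} x (step u∈S uw wv) with PathIn-avoid x wv
  ... | inj₂ tail = inj₂ tail
  ... | inj₁ wv′ with u ≟ x
  ...   | yes refl = inj₂ (inj₂ (_ , uw , wv′))
  ...   | no u≢x   = inj₁ (step (x∈p∧x≢y⇒x∈p-y u∈S u≢x) uw wv′)

  PathIn-first-step : ∀ {S u v} → PathIn G S u v →
    u ≡ v ⊎ ∃[ w ] Adj G u w × PathIn G (S - u) w v
  PathIn-first-step {S} {u} p with PathIn-avoid u p
  ... | inj₂ tail = tail
  ... | inj₁ p′   = ⊥-elim (x∈p─q⇒x∉q S ⁅ u ⁆ (PathIn-head p′) (x∈⁅x⁆ u))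

  PathIn? : ∀ S u v → Dec (PathIn G S u v)
  PathIn? S u v = from S (⊂-wellFounded S) u
    where
    from : ∀ S → Acc _⊂_ S → ∀ u → Dec (PathIn G S u v)
    from S (acc smaller) u with u ∈? S | u ≟ v
    ... | no u∉S  | _        = no (u∉S ∘ PathIn-head)
    ... | yes u∈S | yes refl = yes (here u∈S)
    ... | yes u∈S | no u≢v   = map′ extend shorten
      (any? λ w → T? (adj G u w) ×-dec from (S - u) (smaller (x∈p⇒p-x⊂p u∈S)) w)
      where
      extend : (∃[ w ] Adj G u w × PathIn G (S - u) w v) → PathIn G S u v
      extend (_ , uw , wv) = step u∈S uw (PathIn-mono (p─q⊆p S ⁅ u ⁆) wv)
      shorten : PathIn G S u v → ∃[ w ] Adj G u w × PathIn G (S - u) w v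
      shorten p with PathIn-first-step p
      ... | inj₁ u≡v = ⊥-elim (u≢v u≡v)
      ... | inj₂ exit = exit

  IsClique? : ∀ C → Dec (IsClique G C)
  IsClique? C = all? λ u → all? λ v →
    (u ∈? C) →-dec (v ∈? C) →-dec ¬? (u ≟ v) →-dec T? (adj G u v)

  IsCliqueSeparator? : ∀ S C → Dec (IsCliqueSeparator G S C)
  IsCliqueSeparator? S C = (C ⊆? S) ×-dec IsClique? C ×-dec
    any? λ u → any? λ v → (u ∈? (S ─ C)) ×-dec (v ∈? (S ─ C)) ×-dec ¬? (PathIn? (S ─ C) u v)

  Connected? : ∀ S → Dec (Connected G S)
  Connected? S = any? (_∈? S) ×-dec
    all? λ u → all? λ v → (u ∈? S) →-dec (v ∈? S) →-dec PathIn? S u v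

  IsPrime? : ∀ S → Dec (IsPrime G S)
  IsPrime? S = Connected? S ×-dec map′ (λ ∄ C sep → ∄ (C , sep)) (λ none (C , sep) → none C sep)
    (¬? (anySubset? (IsCliqueSeparator? S)))

  extend-to-MP : ∀ S → IsPrime G S → ∃[ M ] S ⊆ M × IsMP G M
  extend-to-MP S = from S (⊃-wellFounded S)
    where
    from : ∀ S → Acc _⊃_ S → IsPrime G S → ∃[ M ] S ⊆ M × IsMP G M
    from S (acc larger) S-prime with anySubset? (λ T → (S ⊂? T) ×-dec IsPrime? T)
    ... | yes (T , S⊂T , T-prime) with from T (larger S⊂T) T-prime
    ...   | M , T⊆M , M-mp = M , T⊆M ∘ proj₁ S⊂T , M-mp
    from S (acc larger) S-prime | no ∄ = S , id , S-prime , maximal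
      where
      maximal : ∀ T → S ⊆ T → IsPrime G T → T ⊆ S
      maximal T S⊆T T-prime {x} x∈T with x ∈? S
      ... | yes x∈S = x∈S
      ... | no x∉S  = ⊥-elim (∄ (T , (S⊆T , x , x∈T , x∉S) , T-prime))

  clique-prime : ∀ K → IsClique G K → ∃[ u ] u ∈ K → IsPrime G K
  clique-prime K K-clique nonempty = (nonempty , joined) , no-separator
    where
    joined : ∀ u v → u ∈ K → v ∈ K → PathIn G K u v
    joined u v u∈K v∈K with u ≟ v
    ... | yes refl = here u∈K
    ... | no u≢v   = step u∈K (K-clique u v u∈K v∈K u≢v) (here v∈K)
    no-separator : ∀ C → ¬ IsCliqueSeparator G K C
    no-separator C (_ , _ , u , v , u∈K─C , v∈K─C , disconnected) with u ≟ v
    ... | yes refl = disconnected (here u∈K─C)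
    ... | no u≢v   = disconnected (step u∈K─C
          (K-clique u v (p─q⊆p K C u∈K─C) (p─q⊆p K C v∈K─C) u≢v) (here v∈K─C))

  pair : Fin n → Fin n → Subset n
  pair a b = ⁅ a ⁆ ∪ ⁅ b ⁆

  a∈pair : ∀ a b → a ∈ pair a b
  a∈pair a b = x∈p∪q⁺ (inj₁ (x∈⁅x⁆ a))

  b∈pair : ∀ a b → b ∈ pair a b
  b∈pair a b = x∈p∪q⁺ (inj₂ (x∈⁅x⁆ b))

  pair⊆ : ∀ {a b Q} → a ∈ Q → b ∈ Q → pair a b ⊆ Q
  pair⊆ {a} {b} {Q} a∈Q b∈Q w∈ with x∈p∪q⁻ ⁅ a ⁆ ⁅ b ⁆ w∈
  ... | inj₁ w∈⁅a⁆ = subst (_∈ Q) (sym (x∈⁅y⁆⇒x≡y a w∈⁅a⁆)) a∈Q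
  ... | inj₂ w∈⁅b⁆ = subst (_∈ Q) (sym (x∈⁅y⁆⇒x≡y b w∈⁅b⁆)) b∈Q

  ⁅⁆-clique : ∀ a → IsClique G ⁅ a ⁆
  ⁅⁆-clique a u v u∈ v∈ u≢v = ⊥-elim (u≢v (trans (x∈⁅y⁆⇒x≡y a u∈) (sym (x∈⁅y⁆⇒x≡y a v∈))))

  edge-clique : ∀ {a b} → Adj G a b → IsClique G (pair a b)
  edge-clique {a} {b} ab u v u∈ v∈ u≢v
    with x∈p∪q⁻ ⁅ a ⁆ ⁅ b ⁆ u∈ | x∈p∪q⁻ ⁅ a ⁆ ⁅ b ⁆ v∈
  ... | inj₁ u∈⁅a⁆ | inj₁ v∈⁅a⁆ = ⁅⁆-clique a u v u∈⁅a⁆ v∈⁅a⁆ u≢v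
  ... | inj₂ u∈⁅b⁆ | inj₂ v∈⁅b⁆ = ⁅⁆-clique b u v u∈⁅b⁆ v∈⁅b⁆ u≢v
  ... | inj₁ u∈⁅a⁆ | inj₂ v∈⁅b⁆ rewrite x∈⁅y⁆⇒x≡y a u∈⁅a⁆ | x∈⁅y⁆⇒x≡y b v∈⁅b⁆ = ab
  ... | inj₂ u∈⁅b⁆ | inj₁ v∈⁅a⁆ rewrite x∈⁅y⁆⇒x≡y b u∈⁅b⁆ | x∈⁅y⁆⇒x≡y a v∈⁅a⁆ = Adj-sym ab

  edge-prime : ∀ {a b} → Adj G a b → IsPrime G (pair a b)
  edge-prime {a} {b} ab = clique-prime _ (edge-clique ab) (a , a∈pair a b)

  edge-in-MP : ∀ {a b} → Adj G a b → ∃[ M ] a ∈ M × b ∈ M × IsMP G M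
  edge-in-MP {a} {b} ab with extend-to-MP _ (edge-prime ab)
  ... | M , pair⊆M , M-mp = M , pair⊆M (a∈pair a b) , pair⊆M (b∈pair a b) , M-mp

  ΩPath-cons : ∀ {A M B} v → IsMP G A → IsMP G M → v ∈ A → v ∈ M → ΩPath G M B → ΩPath G A B
  ΩPath-cons {A} {M} v A-mp M-mp v∈A v∈M MB with A ≟ₛ M
  ... | yes refl = MB
  ... | no A≢M   = step (A-mp , M-mp , A≢M , v , v∈A , v∈M) MB

  PathIn⇒ΩPath : ∀ {S A B a b} → IsMP G A → a ∈ A → PathIn G S a b → IsMP G B → b ∈ B →
    ΩPath G A B
  PathIn⇒ΩPath {a = a} A-mp a∈A (here _) B-mp a∈B = ΩPath-cons a A-mp B-mp a∈A a∈B (here B-mp)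
  PathIn⇒ΩPath {a = a} A-mp a∈A (step _ aw wb) B-mp b∈B with edge-in-MP aw
  ... | M , a∈M , w∈M , M-mp = ΩPath-cons a A-mp M-mp a∈A a∈M (PathIn⇒ΩPath M-mp w∈M wb B-mp b∈B)

  Ω-connected : Connected G ⊤ → ΩConnected G
  Ω-connected ((u , _) , paths) = some-MP , joined
    where
    some-MP : ∃[ A ] IsMP G A
    some-MP with extend-to-MP ⁅ u ⁆ (clique-prime _ (⁅⁆-clique u) (u , x∈⁅x⁆ u))
    ... | M , _ , M-mp = M , M-mp
    joined : ∀ A B → IsMP G A → IsMP G B → ΩPath G A B
    joined A B A-mp B-mp with proj₁ (proj₁ (proj₁ A-mp)) | proj₁ (proj₁ (proj₁ B-mp))
    ... | a , a∈A | b , b∈B = PathIn⇒ΩPath A-mp a∈A (paths a b ∈⊤ ∈⊤) B-mp b∈B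

  acyclic⇒at-most-two-MP : ¬ ΩHasCycle G → ∀ v → InAtMostTwoMP G v
  acyclic⇒at-most-two-MP acyclic v A B C A-mp B-mp C-mp v∈A v∈B v∈C
    with A ≟ₛ B | A ≟ₛ C | B ≟ₛ C
  ... | yes A≡B | _       | _       = inj₁ A≡B
  ... | no _    | yes A≡C | _       = inj₂ (inj₁ A≡C)
  ... | no _    | no _    | yes B≡C = inj₂ (inj₂ B≡C)
  ... | no A≢B  | no A≢C  | no B≢C  = ⊥-elim (acyclic (A , B ∷ C ∷ [] , s≤s (s≤s z≤n) ,
        A-mp ∷ B-mp ∷ C-mp ∷ [] , (A≢B ∷ A≢C ∷ []) ∷ (B≢C ∷ []) ∷ [] ∷ [] ,
        (A-mp , B-mp , A≢B , v , v∈A , v∈B) , (B-mp , C-mp , B≢C , v , v∈B , v∈C) ,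
        (C-mp , A-mp , ≢-sym A≢C , v , v∈C , v∈A) , tt))

  prime⇒clique-not-separating : ∀ {K C y z} → IsPrime G K → IsClique G C →
    y ∈ K ─ C → z ∈ K ─ C → PathIn G (K ─ C) y z
  prime⇒clique-not-separating {K} {C} {y} {z} K-prime C-clique y∈K─C z∈K─C
    with PathIn? (K ─ C) y z
  ... | yes path = path
  ... | no ¬path = ⊥-elim (proj₂ K-prime (K ∩ C)
        (p∩q⊆p K C , K∩C-clique , y , z , away y∈K─C , away z∈K─C , ¬path ∘ PathIn-mono back))
    where
    K∩C-clique : IsClique G (K ∩ C)
    K∩C-clique a b a∈ b∈ = C-clique a b (p∩q⊆q K C a∈) (p∩q⊆q K C b∈)
    away : ∀ {w} → w ∈ K ─ C → w ∈ K ─ (K ∩ C)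
    away w∈K─C = x∈p∧x∉q⇒x∈p─q (p─q⊆p K C w∈K─C) (x∈p─q⇒x∉q K C w∈K─C ∘ p∩q⊆q K C)
    back : K ─ (K ∩ C) ⊆ K ─ C
    back {w} w∈K─K∩C = x∈p∧x∉q⇒x∈p─q w∈K (x∈p─q⇒x∉q K (K ∩ C) w∈K─K∩C ∘ x∈p∩q⁺ ∘ (w∈K ,_))
      where
      w∈K : w ∈ K
      w∈K = p─q⊆p K (K ∩ C) w∈K─K∩C

-- Cycles of mp-subgraphs

module MPCycle {n : ℕ} (G : Graph n) (at-most-two : ∀ v → InAtMostTwoMP G v)
  (L : ℕ) .{{_ : NonZero L}} (3≤L : 3 ≤ L)
  (A : ℕ → Subset n) (x : ℕ → Fin n)
  (A-periodic : Modulo.Periodic L A) (x-periodic : Modulo.Periodic L x)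
  (A-mp : ∀ t → IsMP G (A t))
  (A-distinct : ∀ {s t} → s < t → t < s + L → A s ≢ A t)
  (x∈A : ∀ t → x t ∈ A t) (x∈A-suc : ∀ t → x t ∈ A (suc t)) where

  open Modulo L
  open GraphTheory G

  1<L : 1 < L
  1<L = ≤-trans (s≤s (s≤s z≤n)) 3≤L

  suc<+L : ∀ t → suc t < t + L
  suc<+L t = subst (_< t + L) (+-comm t 1) (+-monoʳ-< t 1<L)

  suc-suc<+L : ∀ t → suc (suc t) < t + L
  suc-suc<+L t = subst (_< t + L) (+-comm t 2) (+-monoʳ-< t 3≤L)

  A-distinct′ : ∀ {s t M} → s < t → t < s + L → M ≡ A s → M ≢ A t
  A-distinct′ s<t t<s+L M≡As M≡At = A-distinct s<t t<s+L (trans (sym M≡As) M≡At)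

  MP-through-link : ∀ t {M} → IsMP G M → x t ∈ M → M ≡ A t ⊎ M ≡ A (suc t)
  MP-through-link t M-mp xt∈M
    with at-most-two (x t) _ _ _ M-mp (A-mp t) (A-mp (suc t)) xt∈M (x∈A t) (x∈A-suc t)
  ... | inj₁ M≡At          = inj₁ M≡At
  ... | inj₂ (inj₁ M≡At+1) = inj₂ M≡At+1
  ... | inj₂ (inj₂ At≡At+1) = ⊥-elim (A-distinct (n<1+n t) (suc<+L t) At≡At+1)

  x-distinct : ∀ {j h} → j < h → h < j + L → x j ≢ x h
  x-distinct {j} {h} j<h h<j+L xj≡xh
    with MP-through-link j (A-mp h) (subst (_∈ A h) (sym xj≡xh) (x∈A h))
  ... | inj₁ Ah≡Aj   = A-distinct j<h h<j+L (sym Ah≡Aj)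
  ... | inj₂ Ah≡Aj+1 with m≤n⇒m<n∨m≡n j<h
  ...   | inj₁ j+1<h = A-distinct j+1<h (m<n⇒m<1+n h<j+L) (sym Ah≡Aj+1)
  ...   | inj₂ refl
    with MP-through-link j (A-mp (suc h)) (subst (_∈ A (suc h)) (sym xj≡xh) (x∈A-suc h))
  ...     | inj₁ Aj+2≡Aj   = A-distinct (m<n⇒m<1+n j<h) (suc-suc<+L j) (sym Aj+2≡Aj)
  ...     | inj₂ Aj+2≡Aj+1 = A-distinct (n<1+n h) (suc<+L h) (sym Aj+2≡Aj+1)

  shared-MP⇒consecutive : ∀ {j h M} → IsMP G M → x j ∈ M → x h ∈ M → j < h → h < j + L →
    suc j ≡ h ⊎ suc h ≡ j + L
  shared-MP⇒consecutive {j} {h} M-mp xj∈M xh∈M j<h h<j+L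
    with MP-through-link j M-mp xj∈M | MP-through-link h M-mp xh∈M
  ... | inj₁ M≡Aj   | inj₁ M≡Ah   = ⊥-elim (A-distinct′ j<h h<j+L M≡Aj M≡Ah)
  ... | inj₂ M≡Aj+1 | inj₂ M≡Ah+1 = ⊥-elim (A-distinct′ (s≤s j<h) (s≤s h<j+L) M≡Aj+1 M≡Ah+1)
  ... | inj₁ M≡Aj   | inj₂ M≡Ah+1 with m≤n⇒m<n∨m≡n h<j+L
  ...   | inj₁ h+1<j+L = ⊥-elim (A-distinct′ (m<n⇒m<1+n j<h) h+1<j+L M≡Aj M≡Ah+1)
  ...   | inj₂ h+1≡j+L = inj₂ h+1≡j+L
  shared-MP⇒consecutive M-mp xj∈M xh∈M j<h h<j+L | inj₂ M≡Aj+1 | inj₁ M≡Ah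
    with m≤n⇒m<n∨m≡n j<h
  ...   | inj₁ j+1<h = ⊥-elim (A-distinct′ j+1<h (m<n⇒m<1+n h<j+L) M≡Aj+1 M≡Ah)
  ...   | inj₂ j+1≡h = inj₁ j+1≡h

  -- Instantiated with the two S-crossings met going round the cycle from u to v and back to u.
  crossing-links-consecutive : ∀ {S j f k h} → IsClique G S → j ≤ f → f < k → k ≤ h → h < j + L →
    x j ∈ S → x k ∈ S → x h ∈ S → x (suc f) ∈ S ⊎ x (suc h) ∈ S
  crossing-links-consecutive {S} {j} {f} {k} {h} S-clique j≤f f<k k≤h h<j+L xj∈S xk∈S xh∈S
    with ≤-<-trans j≤f (<-≤-trans f<k k≤h)
  ... | j<h with edge-in-MP (S-clique (x j) (x h) xj∈S xh∈S (x-distinct j<h h<j+L))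
  ... | M , xj∈M , xh∈M , M-mp with shared-MP⇒consecutive M-mp xj∈M xh∈M j<h h<j+L
  ...   | inj₁ refl = inj₁ (subst (λ r → x r ∈ S) (≤-antisym (≤-trans k≤h (s≤s j≤f)) f<k) xk∈S)
  ...   | inj₂ h+1≡j+L =
    inj₂ (subst (_∈ S) (x-periodic j (suc h) (sym (trans (cong (_% L) h+1≡j+L) (+L-≈ j)))) xj∈S)

  record PrimeRefinement : Set where
    field
      P          : ℕ → Subset n
      P-periodic : Periodic P
      P-prime    : ∀ t → IsPrime G (P t)
      x∈P        : ∀ t → x t ∈ P t
      x∈P-suc    : ∀ t → x t ∈ P (suc t)

  weight : PrimeRefinement → ℕ
  weight R = sumBelow (λ r → ∣ PrimeRefinement.P R r ∣) L

  module Refinement (R : PrimeRefinement) where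
    open PrimeRefinement R

    Shrinks : Set
    Shrinks = Σ PrimeRefinement λ R′ → weight R′ < weight R

    replace-at : ℕ → Subset n → ℕ → Subset n
    replace-at k Q t with t ≈? k
    ... | yes _ = Q
    ... | no  _ = P t

    shrink-at : ∀ i → Adj G (x i) (x (suc i)) → pair (x i) (x (suc i)) ⊂ P (suc i) → Shrinks
    shrink-at i adjacent E⊂Pk = R′ , sumBelow-mono-< smaller-or-equal (m%n<n k L) smaller
      where
      k : ℕ
      k = suc i

      E : Subset n
      E = pair (x i) (x k)

      P′ : ℕ → Subset n
      P′ = replace-at k E

      P′-periodic : Periodic P′
      P′-periodic s t s≈t with s ≈? k | t ≈? k
      ... | yes _   | yes _   = refl
      ... | no _    | no _    = P-periodic s t s≈t
      ... | yes s≈k | no t≉k  = ⊥-elim (t≉k (trans (sym s≈t) s≈k))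
      ... | no s≉k  | yes t≈k = ⊥-elim (s≉k (trans s≈t t≈k))

      P′-prime : ∀ t → IsPrime G (P′ t)
      P′-prime t with t ≈? k
      ... | yes _ = edge-prime adjacent
      ... | no  _ = P-prime t

      x∈P′ : ∀ t → x t ∈ P′ t
      x∈P′ t with t ≈? k
      ... | yes t≈k = subst (_∈ E) (sym (x-periodic t k t≈k)) (b∈pair (x i) (x k))
      ... | no  _   = x∈P t

      x∈P′-suc : ∀ t → x t ∈ P′ (suc t)
      x∈P′-suc t with suc t ≈? k
      ... | yes t+1≈k = subst (_∈ E) (sym (x-periodic t i (suc-cancel-≈ t+1≈k))) (a∈pair (x i) (x k))
      ... | no  _     = x∈P-suc t

      R′ : PrimeRefinement
      R′ = record { P = P′ ; P-periodic = P′-periodic ; P-prime = P′-prime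
                  ; x∈P = x∈P′ ; x∈P-suc = x∈P′-suc }

      E<P : ∀ r → r ≈ k → ∣ E ∣ < ∣ P r ∣
      E<P r r≈k = subst (λ Q → ∣ E ∣ < ∣ Q ∣) (P-periodic k r (sym r≈k)) (p⊂q⇒∣p∣<∣q∣ E⊂Pk)

      smaller-or-equal : ∀ r → ∣ P′ r ∣ ≤ ∣ P r ∣
      smaller-or-equal r with r ≈? k
      ... | yes r≈k = <⇒≤ (E<P r r≈k)
      ... | no  _   = ≤-refl

      smaller : ∣ P′ (k % L) ∣ < ∣ P (k % L) ∣
      smaller with k % L ≈? k
      ... | yes r≈k = E<P (k % L) r≈k
      ... | no  r≉k = ⊥-elim (r≉k (%-≈ k))

    X : Subset n
    X = ⋃below P L

    P⊆X : ∀ t → P t ⊆ X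
    P⊆X t y∈Pt = ⊆-⋃below P (m%n<n t L) (subst (_ ∈_) (P-periodic t (t % L) (sym (%-≈ t))) y∈Pt)

    path-in-piece : ∀ t {y z} → y ∈ P t → z ∈ P t → PathIn G X y z
    path-in-piece t y∈Pt z∈Pt = PathIn-mono (P⊆X t) (proj₂ (proj₁ (P-prime t)) _ _ y∈Pt z∈Pt)

    path-in-X : ∀ {s} t {y z} → s ≤ t → y ∈ P s → z ∈ P t → PathIn G X y z
    path-in-X t s≤t y∈Ps z∈Pt with m≤n⇒m<n∨m≡n s≤t
    ... | inj₂ refl = path-in-piece t y∈Ps z∈Pt
    path-in-X (suc t) _ y∈Ps z∈Pt | inj₁ (s≤s s≤t) =
      path-in-X t s≤t y∈Ps (x∈P t) ++ₚ path-in-piece (suc t) (x∈P-suc t) z∈Pt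

    X-connected : Connected G X
    X-connected = (x 0 , P⊆X 0 (x∈P 0)) , joined
      where
      joined : ∀ y z → y ∈ X → z ∈ X → PathIn G X y z
      joined y z y∈X z∈X with ∈-⋃below⁻ P L y∈X | ∈-⋃below⁻ P L z∈X
      ... | s , _ , y∈Ps | t , _ , z∈Pt with ≤-total s t
      ...   | inj₁ s≤t = path-in-X t s≤t y∈Ps z∈Pt
      ...   | inj₂ t≤s = PathIn-reverse (path-in-X s t≤s z∈Pt y∈Ps)

    X-not-prime : ¬ IsPrime G X
    X-not-prime X-prime with extend-to-MP X X-prime
    ... | M , X⊆M , M-mp
      with MP-through-link 0 M-mp (link∈M 0) | MP-through-link 1 M-mp (link∈M 1)
         | MP-through-link 2 M-mp (link∈M 2)
      where
      link∈M : ∀ t → x t ∈ M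
      link∈M t = X⊆M (P⊆X t (x∈P t))
    ... | inj₁ M≡A0 | inj₁ M≡A1 | _        = A-distinct′ (s≤s z≤n) 1<L M≡A0 M≡A1
    ... | inj₁ M≡A0 | inj₂ M≡A2 | _        = A-distinct′ (s≤s z≤n) 3≤L M≡A0 M≡A2
    ... | inj₂ M≡A1 | inj₂ M≡A2 | _        = A-distinct′ ≤-refl (m<n⇒m<1+n 3≤L) M≡A1 M≡A2
    ... | inj₂ M≡A1 | inj₁ _    | inj₁ M≡A2 = A-distinct′ ≤-refl (m<n⇒m<1+n 3≤L) M≡A1 M≡A2
    ... | inj₂ M≡A1 | inj₁ _    | inj₂ M≡A3 = A-distinct′ (s≤s (s≤s z≤n)) (s≤s 3≤L) M≡A1 M≡A3

    P─S⊆X─S : ∀ {t S} → P t ─ S ⊆ X ─ S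
    P─S⊆X─S {t} {S} y∈ = x∈p∧x∉q⇒x∈p─q (P⊆X t (p─q⊆p (P t) S y∈)) (x∈p─q⇒x∉q (P t) S y∈)

    module Separated (S : Subset n) (S-clique : IsClique G S) {u v p q}
      (u∈Pp─S : u ∈ P p ─ S) (v∈Pq─S : v ∈ P q ─ S) (u↮v : ¬ PathIn G (X ─ S) u v)
      (p≤q : p ≤ q) (q<p+L : q < p + L) where

      Reached Unreached : ℕ → Set
      Reached   t = ∃[ y ] y ∈ P t ─ S × PathIn G (X ─ S) u y
      Unreached t = ∃[ y ] y ∈ P t ─ S × ¬ PathIn G (X ─ S) u y

      transfer : ∀ t {y z} → y ∈ P t ─ S → z ∈ P t ─ S →
        PathIn G (X ─ S) u y → PathIn G (X ─ S) u z
      transfer t y∈ z∈ u→y =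
        u→y ++ₚ PathIn-mono P─S⊆X─S (prime⇒clique-not-separating (P-prime t) S-clique y∈ z∈)

      x∈P─S : ∀ {t} → x t ∉ S → x t ∈ P t ─ S
      x∈P─S {t} xt∉S = x∈p∧x∉q⇒x∈p─q (x∈P t) xt∉S

      x∈P-suc─S : ∀ {t} → x t ∉ S → x t ∈ P (suc t) ─ S
      x∈P-suc─S {t} xt∉S = x∈p∧x∉q⇒x∈p─q (x∈P-suc t) xt∉S

      reached-forward : ∀ {t} → Reached t → x t ∉ S → Reached (suc t)
      reached-forward {t} (y , y∈ , u→y) xt∉S =
        x t , x∈P-suc─S xt∉S , transfer t y∈ (x∈P─S xt∉S) u→y

      reached-backward : ∀ {t} → Reached (suc t) → x t ∉ S → Reached t
      reached-backward {t} (y , y∈ , u→y) xt∉S =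
        x t , x∈P─S xt∉S , transfer (suc t) y∈ (x∈P-suc─S xt∉S) u→y

      unreached-forward : ∀ {t} → Unreached t → x t ∉ S → Unreached (suc t)
      unreached-forward {t} (y , y∈ , u↛y) xt∉S =
        x t , x∈P-suc─S xt∉S , u↛y ∘ transfer t (x∈P─S xt∉S) y∈

      unreached-backward : ∀ {t} → Unreached (suc t) → x t ∉ S → Unreached t
      unreached-backward {t} (y , y∈ , u↛y) xt∉S =
        x t , x∈P─S xt∉S , u↛y ∘ transfer (suc t) (x∈P-suc─S xt∉S) y∈

      exclusive : ∀ {t} → Reached t → ¬ Unreached t
      exclusive {t} (y , y∈ , u→y) (z , z∈ , u↛z) = u↛z (transfer t y∈ z∈ u→y)

      module Forward  = Crossing Reached Unreached (λ t → x t ∈ S) (λ t → x t ∈? S)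
                          reached-forward unreached-backward exclusive
      module Backward = Crossing Unreached Reached (λ t → x t ∈ S) (λ t → x t ∈? S)
                          unreached-forward reached-backward (λ un re → exclusive re un)

      reached-p+L : Reached (p + L)
      reached-p+L =
        u , subst (λ Q → u ∈ Q ─ S) (P-periodic p (p + L) (sym (+L-≈ p))) u∈Pp─S , here (P─S⊆X─S u∈Pp─S)

      consecutive-links-in-S : ∃[ i ] x i ∈ S × x (suc i) ∈ S × ∃[ y ] y ∈ P (suc i) ─ S
      consecutive-links-in-S
        with Forward.crossing p≤q (u , u∈Pp─S , here (P─S⊆X─S u∈Pp─S)) (v , v∈Pq─S , u↮v)
           | Backward.crossing (<⇒≤ q<p+L) (v , v∈Pq─S , u↮v) reached-p+L
      ... | j , f , p≤j , j≤f , f<q , xj∈S , xf∈S , _ , (y , y∈ , _)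
          | k , h , q≤k , k≤h , h<p+L , xk∈S , xh∈S , _ , (z , z∈ , _)
        with crossing-links-consecutive S-clique j≤f (<-≤-trans f<q q≤k) k≤h
               (<-≤-trans h<p+L (+-monoˡ-≤ L p≤j)) xj∈S xk∈S xh∈S
      ... | inj₁ xf+1∈S = f , xf∈S , xf+1∈S , y , y∈
      ... | inj₂ xh+1∈S = h , xh∈S , xh+1∈S , z , z∈

    piece-of : ∀ {S y} → y ∈ X ─ S → ∃[ t ] t < L × y ∈ P t ─ S
    piece-of {S} y∈X─S with ∈-⋃below⁻ P L (p─q⊆p X S y∈X─S)
    ... | t , t<L , y∈Pt = t , t<L , x∈p∧x∉q⇒x∈p─q y∈Pt (x∈p─q⇒x∉q X S y∈X─S)

    shrink-through : ∀ {S} → IsClique G S →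
      ∃[ i ] x i ∈ S × x (suc i) ∈ S × ∃[ y ] y ∈ P (suc i) ─ S → Shrinks
    shrink-through {S} S-clique (i , xi∈S , xi+1∈S , y , y∈Pi+1─S) =
      shrink-at i (S-clique _ _ xi∈S xi+1∈S (x-distinct (n<1+n i) (suc<+L i)))
        (pair⊆ (x∈P-suc i) (x∈P (suc i)) , y , p─q⊆p _ S y∈Pi+1─S ,
         x∈p─q⇒x∉q _ S y∈Pi+1─S ∘ pair⊆ xi∈S xi+1∈S)

    shrink : Shrinks
    shrink with anySubset? (IsCliqueSeparator? X)
    ... | no ∄separator = ⊥-elim (X-not-prime (X-connected , λ C sep → ∄separator (C , sep)))
    ... | yes (S , _ , S-clique , u , v , u∈X─S , v∈X─S , u↮v)
      with piece-of u∈X─S | piece-of v∈X─S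
    ... | p , p<L , u∈Pp─S | q , q<L , v∈Pq─S with ≤-total p q
    ...   | inj₁ p≤q = shrink-through S-clique (Separated.consecutive-links-in-S S S-clique
              u∈Pp─S v∈Pq─S u↮v p≤q (<-≤-trans q<L (m≤n+m L p)))
    ...   | inj₂ q≤p = shrink-through S-clique (Separated.consecutive-links-in-S S S-clique
              v∈Pq─S u∈Pp─S (u↮v ∘ PathIn-reverse) q≤p (<-≤-trans p<L (m≤n+m L q)))

  no-refinement : (R : PrimeRefinement) → Acc _<_ (weight R) → ⊥
  no-refinement R (acc smaller) with Refinement.shrink R
  ... | R′ , R′<R = no-refinement R′ (smaller R′<R)

  impossible : ⊥
  impossible = no-refinement (record { P = A ; P-periodic = A-periodic ; P-prime = proj₁ ∘ A-mp
                                        ; x∈P = x∈A ; x∈P-suc = x∈A-suc }) (<-wellFounded _)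

module _ {n : ℕ} (G : Graph n) where

  ΩAdj-shared : ∀ {B C} → ΩAdj G B C → ∃[ v ] v ∈ B × v ∈ C
  ΩAdj-shared (_ , _ , _ , shared) = shared

  at : List (Subset n) → ℕ → Subset n
  at []       _       = ∅
  at (a ∷ as) zero    = a
  at (a ∷ as) (suc r) = at as r

  All-at : ∀ {Q : Subset n → Set} {as r} → All Q as → r < length as → Q (at as r)
  All-at {r = zero}  (qa ∷ _)  _        = qa
  All-at {r = suc r} (_ ∷ qas) (s≤s r<) = All-at qas r<

  Unique-at-injective : ∀ {as i j} → Unique as → i < length as → j < length as →
    at as i ≡ at as j → i ≡ j
  Unique-at-injective {i = zero}  {zero}  _ _ _ _ = refl
  Unique-at-injective {i = zero}  {suc j} (a≢ ∷ _) _ (s≤s j<) a≡ = ⊥-elim (All-at a≢ j< a≡)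
  Unique-at-injective {i = suc i} {zero}  (a≢ ∷ _) (s≤s i<) _ ≡a = ⊥-elim (All-at a≢ i< (sym ≡a))
  Unique-at-injective {i = suc i} {suc j} (_ ∷ u) (s≤s i<) (s≤s j<) e =
    cong suc (Unique-at-injective u i< j< e)

  at-∷ʳ-< : ∀ as {a r} → r < length as → at (as ∷ʳ a) r ≡ at as r
  at-∷ʳ-< (_ ∷ _)  {r = zero}  _        = refl
  at-∷ʳ-< (_ ∷ as) {r = suc r} (s≤s r<) = at-∷ʳ-< as r<

  at-∷ʳ-length : ∀ as {a} → at (as ∷ʳ a) (length as) ≡ a
  at-∷ʳ-length []       = refl
  at-∷ʳ-length (_ ∷ as) = at-∷ʳ-length as

  Linked-∷ʳ-at : ∀ as {a r} → Linked G (as ∷ʳ a) → r < length as →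
    ΩAdj G (at as r) (at (as ∷ʳ a) (suc r))
  Linked-∷ʳ-at (_ ∷ [])     {r = zero}  (adj , _) _        = adj
  Linked-∷ʳ-at (_ ∷ [])     {r = suc _} _         (s≤s ())
  Linked-∷ʳ-at (_ ∷ _ ∷ _)  {r = zero}  (adj , _) _        = adj
  Linked-∷ʳ-at (_ ∷ b ∷ as) {r = suc r} (_ , linked) (s≤s r<) = Linked-∷ʳ-at (b ∷ as) linked r<

  module ListCycle (at-most-two : ∀ v → InAtMostTwoMP G v)
    (A₀ : Subset n) (rest : List (Subset n)) (2≤rest : 2 ≤ length rest)
    (all-mp : All (IsMP G) (A₀ ∷ rest)) (unique : Unique (A₀ ∷ rest))
    (linked : Linked G ((A₀ ∷ rest) ∷ʳ A₀)) where

    cycle : List (Subset n)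
    cycle = A₀ ∷ rest

    L : ℕ
    L = length cycle

    open Modulo L

    A : ℕ → Subset n
    A t = at cycle (t % L)

    A-periodic : Periodic A
    A-periodic _ _ = cong (at cycle)

    A-distinct : ∀ {s t} → s < t → t < s + L → A s ≢ A t
    A-distinct {s} {t} s<t t<s+L As≡At =
      ≉-within-period s<t t<s+L (Unique-at-injective unique (m%n<n s L) (m%n<n t L) As≡At)

    A-mp : ∀ t → IsMP G (A t)
    A-mp t = All-at all-mp (m%n<n t L)

    closed-cycle-at : ∀ {r} → r ≤ L → at (cycle ∷ʳ A₀) r ≡ A r
    closed-cycle-at {r} r≤L with m≤n⇒m<n∨m≡n r≤L
    ... | inj₁ r<L = trans (at-∷ʳ-< cycle r<L) (cong (at cycle) (sym (m<n⇒m%n≡m r<L)))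
    ... | inj₂ refl = trans (at-∷ʳ-length cycle) (cong (at cycle) (sym (n%n≡0 L)))

    link : ∀ t → ΩAdj G (A t) (A (suc t))
    link t = subst (ΩAdj G (A t)) (trans (closed-cycle-at t%L<L) (cong (at cycle) (+-congˡ-≈ 1 (%-≈ t))))
      (Linked-∷ʳ-at cycle linked t%L<L)
      where
      t%L<L : t % L < L
      t%L<L = m%n<n t L

    x : ℕ → Fin n
    x t = proj₁ (ΩAdj-shared (link (t % L)))

    x-periodic : Periodic x
    x-periodic _ _ s≈t = cong (λ r → proj₁ (ΩAdj-shared (link r))) s≈t

    x∈A : ∀ t → x t ∈ A t
    x∈A t = subst (x t ∈_) (cong (at cycle) (%-≈ t)) (proj₁ (proj₂ (ΩAdj-shared (link (t % L)))))

    x∈A-suc : ∀ t → x t ∈ A (suc t)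
    x∈A-suc t = subst (x t ∈_) (cong (at cycle) (+-congˡ-≈ 1 (%-≈ t)))
      (proj₂ (proj₂ (ΩAdj-shared (link (t % L)))))

    impossible : ⊥
    impossible = MPCycle.impossible G at-most-two L (s≤s 2≤rest) A x A-periodic x-periodic
                      A-mp A-distinct x∈A x∈A-suc

  Ω-acyclic : (∀ v → InAtMostTwoMP G v) → ¬ ΩHasCycle G
  Ω-acyclic at-most-two (A₀ , rest , 2≤rest , all-mp , unique , linked) =
    ListCycle.impossible at-most-two A₀ rest 2≤rest all-mp unique linked

lemma7 : ∀ (n : ℕ) (G : Graph n) → Connected G ⊤ →
    (InΓ₂ G → ∀ v → InAtMostTwoMP G v) × ((∀ v → InAtMostTwoMP G v) → InΓ₂ G)
lemma7 n G connected =
  (λ (_ , acyclic) → acyclic⇒at-most-two-MP acyclic) ,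
  (λ at-most-two → Ω-connected connected , Ω-acyclic G at-most-two)
  where open GraphTheory G
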